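{- Let $G$ be a strongly connected compressed directed graph that is not a closed path, and let $e$ be an arc of $G$. (i) If $e$ is not a bivalent arc, then there is at most one maximal microtig of $G$ containing $e$. (ii) If $e$ is a bivalent arc, then there are at most two maximal microtigs containing $e$, of which at most one is of the form $eW_1$ and at most one is of the form $W_2e$.
   Context: Graphs are finite directed multigraphs (parallel arcs and self-loops allowed); $t(e)$, $h(e)$ are tail and head of arc $e$. A path is a walk with distinct nodes except the last may equal the first. A closed path is a graph consisting of a single cycle. A node is a join node if its in-degree exceeds 1, a split node if its out-degree exceeds 1, biunivocal if neither. An arc $e$ is a join arc if $h(e)$ is a join node, a split arc if $t(e)$ is a split node, bivalent if both, biunivocal if neither. A graph is compressed if it has no biunivocal nodes and no biunivocal arcs. A walk $W=e_0\dots e_\ell$ is an omnitig if for all $1\le i\le j\le \ell$ there is no non-empty path from $t(e_j)$ to $h(e_{i-1})$ whose first arc differs from $e_j$ and whose last arc differs from $e_{i-1}$. A central-micro omnitig is an omnitig $fg$ with $f$ a join arc and $g$ a split arc. A right-micro omnitig (resp. left-micro omnitig) is an omnitig $fgW$ (resp. $Wfg$), with $fg$ a central-micro omnitig, not containing a bivalent arc as an internal arc. A microtig is a walk $W_1fgW_2$ where $W_1fg$ is a left-micro omnitig and $fgW_2$ a right-micro omnitig; it is maximal if no arc can be added on either side to obtain a microtig. -}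

module Defs where

open import Data.Nat using (ℕ; _>_; _≤_)
open import Data.Fin using (Fin)
open import Data.Fin.Properties using (_≟_)
open import Data.List using (List; []; _∷_; _++_; [_]; map; filter; length; allFin)
open import Data.List.Membership.Propositional using (_∈_)
open import Data.List.Relation.Unary.Unique.Propositional using (Unique)
open import Data.Product using (Σ; ∃; _×_; _,_)
open import Data.Sum using (_⊎_)
open import Data.Unit using (⊤)
open import Data.Empty using (⊥)
open import Relation.Nullary using (¬_)
open import Relation.Binary.PropositionalEquality using (_≡_; _≢_)

record Graph : Set where
  field
    n  : ℕ
    m  : ℕ
    tl : Fin m → Fin n
    hd : Fin m → Fin n

module _ (G : Graph) where
  open Graph G

  Node : Set
  Node = Fin n

  Arc : Set
  Arc = Fin m

  indeg : Node → ℕ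
  indeg v = length (filter (λ e → hd e ≟ v) (allFin m))

  outdeg : Node → ℕ
  outdeg v = length (filter (λ e → tl e ≟ v) (allFin m))

  JoinNode : Node → Set
  JoinNode v = indeg v > 1

  SplitNode : Node → Set
  SplitNode v = outdeg v > 1

  BiunivocalNode : Node → Set
  BiunivocalNode v = ¬ JoinNode v × ¬ SplitNode v

  JoinArc : Arc → Set
  JoinArc e = JoinNode (hd e)

  SplitArc : Arc → Set
  SplitArc e = SplitNode (tl e)

  BivalentArc : Arc → Set
  BivalentArc e = JoinArc e × SplitArc e

  BiunivocalArc : Arc → Set
  BiunivocalArc e = ¬ JoinArc e × ¬ SplitArc e

  Compressed : Set
  Compressed = (∀ v → ¬ BiunivocalNode v) × (∀ e → ¬ BiunivocalArc e)

  IsWalk : List Arc → Set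
  IsWalk []             = ⊤
  IsWalk (e ∷ [])       = ⊤
  IsWalk (e ∷ e′ ∷ es)  = hd e ≡ tl e′ × IsWalk (e′ ∷ es)

  FirstLast : List Arc → Arc → Arc → Set
  FirstLast P f l = Σ (List Arc) λ xs → Σ (List Arc) λ ys → P ≡ f ∷ xs × P ≡ ys ++ [ l ]

  WalkFromTo : Node → Node → List Arc → Set
  WalkFromTo u v P = IsWalk P ×
    ((P ≡ [] × u ≡ v) ⊎ (Σ Arc λ f → Σ Arc λ l → FirstLast P f l × tl f ≡ u × hd l ≡ v))

  StronglyConnected : Set
  StronglyConnected = ∀ u v → ∃ λ P → WalkFromTo u v P

  -- path: a walk whose nodes t(e₁), h(e₁), …, h(e_k) are distinct, except that the
  -- last may equal the first; equivalently t(e₁)…t(e_k) distinct and h(e₁)…h(e_k) distinct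
  IsPath : List Arc → Set
  IsPath P = IsWalk P × Unique (map tl P) × Unique (map hd P)

  IsClosedPath : Set
  IsClosedPath = Σ (List Arc) λ C → Σ Arc λ f → Σ Arc λ l →
    IsPath C × FirstLast C f l × hd l ≡ tl f × (∀ a → a ∈ C) × (∀ v → v ∈ map tl C)

  IsOmnitig : List Arc → Set
  IsOmnitig W = IsWalk W × W ≢ [] ×
    (∀ (X : List Arc) (a : Arc) (Y : List Arc) (b : Arc) (Z : List Arc) →
       W ≡ X ++ a ∷ Y ++ b ∷ Z →
       ¬ (Σ (List Arc) λ P → Σ Arc λ f → Σ Arc λ l →
            IsPath P × FirstLast P f l × tl f ≡ tl b × hd l ≡ hd a × f ≢ b × l ≢ a))

  CentralMicro : Arc → Arc → Set
  CentralMicro f g = IsOmnitig (f ∷ g ∷ []) × JoinArc f × SplitArc g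

  NoInternalBivalent : List Arc → Set
  NoInternalBivalent W = ∀ (X : List Arc) (a : Arc) (Y : List Arc) →
    W ≡ X ++ a ∷ Y → X ≢ [] → Y ≢ [] → ¬ BivalentArc a

  RightMicro : Arc → Arc → List Arc → Set
  RightMicro f g W = IsOmnitig (f ∷ g ∷ W) × CentralMicro f g × NoInternalBivalent (f ∷ g ∷ W)

  LeftMicro : List Arc → Arc → Arc → Set
  LeftMicro W f g = IsOmnitig (W ++ f ∷ g ∷ []) × CentralMicro f g
                    × NoInternalBivalent (W ++ f ∷ g ∷ [])

  IsMicrotig : List Arc → Set
  IsMicrotig M = Σ (List Arc) λ W₁ → Σ Arc λ f → Σ Arc λ g → Σ (List Arc) λ W₂ →
    M ≡ W₁ ++ f ∷ g ∷ W₂ × LeftMicro W₁ f g × RightMicro f g W₂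

  MaximalMicrotig : List Arc → Set
  MaximalMicrotig M = IsMicrotig M ×
    (∀ a → ¬ IsMicrotig (a ∷ M)) × (∀ a → ¬ IsMicrotig (M ++ [ a ]))

-- In a compressed graph every node is a join or a split node. Hence in a right-micro
-- omnitig f g W all arcs after f are split arcs (a split arc that is not bivalent ends in
-- a non-join, hence split, node), and dually in a left-micro omnitig W f g all arcs up to
-- f are join arcs. Strong connectivity gives a path into h(f) whose last arc is not f;
-- the omnitig condition forces it to run along g W, so two right extensions of f g can
-- never diverge, and dually on the left. Together with the fact that f and g determine
-- each other, a maximal microtig is determined by its central pair. A non-split arc e of
-- a microtig lies in its left part W f, and the arcs from e up to f are forced (each is
-- the only arc leaving a non-split node), so e determines f and hence the microtig;
-- non-join arcs follow by reversing all arcs. A bivalent arc can only be the first or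
-- the last arc of a microtig, and the same argument applies at that end.

module Submission where

open import Defs
open import Data.Empty using (⊥; ⊥-elim)
open import Data.Fin using (Fin)
open import Data.Fin.Properties using (_≟_)
open import Data.List using (List; []; _∷_; _++_; [_]; map; reverse; length; filter; allFin)
open import Data.List.Properties
  using (++-assoc; ++-identityʳ; ++-conicalˡ; ++-conicalʳ; ∷-injective; ∷-injectiveʳ; ∷ʳ-injective;
         reverse-++; unfold-reverse; reverse-involutive; reverse-selfInverse; reverse-injective; reverse-map)
open import Data.List.Membership.Propositional using (_∈_; _∉_)
open import Data.List.Membership.Propositional.Properties using (∈-++⁻; ∈-∃++; ∈-filter⁺; ∈-filter⁻; ∈-allFin)
open import Data.List.Relation.Binary.Permutation.Propositional.Properties using (All-resp-↭; ↭-reverse)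
import Data.List.Relation.Binary.Permutation.Setoid as Perm
import Data.List.Relation.Binary.Permutation.Setoid.Properties as Perm
open import Data.List.Relation.Unary.All using (All; []; _∷_)
import Data.List.Relation.Unary.All as All
open import Data.List.Relation.Unary.All.Properties using (¬Any⇒All¬; ++⁻ˡ; ++⁻ʳ)
open import Data.List.Relation.Unary.AllPairs using ([]; _∷_)
open import Data.List.Relation.Unary.Any using (here; there)
open import Data.List.Relation.Unary.Any.Properties using (reverse⁺)
open import Data.List.Relation.Unary.Unique.Propositional using (Unique)
open import Data.List.Relation.Unary.Unique.Propositional.Properties using (Unique[x∷xs]⇒x∉xs; allFin⁺; filter⁺)
open import Data.Nat using (ℕ; _<_; _<?_; s≤s; z≤n)
open import Data.Nat.Properties using (m<n⇒m<1+n)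
open import Data.Product using (∃-syntax; _×_; _,_; proj₁; proj₂)
open import Data.Sum using (_⊎_; inj₁; inj₂)
open import Function using (case_of_)
open import Level using (0ℓ)
open import Relation.Binary using (DecidableEquality)
open import Relation.Binary.PropositionalEquality using (_≡_; _≢_; refl; sym; trans; cong; cong₂; subst; setoid)
open import Relation.Nullary using (¬_; yes; no)
open import Relation.Unary using (Pred; Decidable)

module _ {A : Set} where

  distinct-members⇒1<length : ∀ {a b : A} {xs} → a ∈ xs → b ∈ xs → a ≢ b → 1 < length xs
  distinct-members⇒1<length (here refl) (here refl) a≢b = ⊥-elim (a≢b refl)
  distinct-members⇒1<length {xs = _ ∷ _ ∷ _} (here _) (there _) _ = s≤s (s≤s z≤n)
  distinct-members⇒1<length {xs = _ ∷ _ ∷ _} (there _) (here _) _ = s≤s (s≤s z≤n)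
  distinct-members⇒1<length {xs = _ ∷ []} (here _) (there ()) _
  distinct-members⇒1<length {xs = _ ∷ []} (there ()) _ _
  distinct-members⇒1<length (there a∈) (there b∈) a≢b = m<n⇒m<1+n (distinct-members⇒1<length a∈ b∈ a≢b)

  member-other-than : DecidableEquality A → ∀ {xs} → Unique xs → 1 < length xs →
    ∀ a → ∃[ b ] b ≢ a × b ∈ xs
  member-other-than _≟_ {x ∷ y ∷ _} ((x≢y ∷ _) ∷ _) _ a with x ≟ a
  ... | no x≢a = x , x≢a , here refl
  ... | yes refl = y , (λ y≡x → x≢y (sym y≡x)) , there (here refl)
  member-other-than _ {_ ∷ []} _ (s≤s ()) _

  ∉⇒Unique-∷ : ∀ {x : A} {xs} → x ∉ xs → Unique xs → Unique (x ∷ xs)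
  ∉⇒Unique-∷ x∉xs u = ¬Any⇒All¬ _ x∉xs ∷ u

  Unique-tail : ∀ {x : A} {xs} → Unique (x ∷ xs) → Unique xs
  Unique-tail (_ ∷ u) = u

  ∷ʳ-≢[] : ∀ (xs : List A) x → xs ++ [ x ] ≢ []
  ∷ʳ-≢[] [] _ ()
  ∷ʳ-≢[] (_ ∷ _) _ ()

  ∷-as-snoc : ∀ (x : A) xs → ∃[ ys ] ∃[ l ] x ∷ xs ≡ ys ++ [ l ]
  ∷-as-snoc x [] = [] , x , refl
  ∷-as-snoc x (y ∷ xs) with ∷-as-snoc y xs
  ... | ys , l , eq = x ∷ ys , l , cong (x ∷_) eq

  last-determined : ∀ {xs a X e Y xs′ a′ X′} → xs ++ [ a ] ≡ X ++ e ∷ Y → xs′ ++ [ a′ ] ≡ X′ ++ e ∷ Y → a ≡ a′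
  last-determined {xs} {a} {X} {e} {Y} {xs′} {a′} {X′} eq eq′ with ∷-as-snoc e Y
  ... | ys , l , e∷Y≡ys∷ʳl =
    trans (proj₂ (∷ʳ-injective xs (X ++ ys) (trans eq (shift X))))
          (sym (proj₂ (∷ʳ-injective xs′ (X′ ++ ys) (trans eq′ (shift X′)))))
    where
    shift : ∀ Z → Z ++ e ∷ Y ≡ (Z ++ ys) ++ [ l ]
    shift Z = trans (cong (Z ++_) e∷Y≡ys∷ʳl) (sym (++-assoc Z ys [ l ]))

  PrefixComparable : List A → List A → Set
  PrefixComparable xs ys = (∃[ zs ] ys ≡ xs ++ zs) ⊎ (∃[ zs ] xs ≡ ys ++ zs)

  SuffixComparable : List A → List A → Set
  SuffixComparable xs ys = (∃[ zs ] ys ≡ zs ++ xs) ⊎ (∃[ zs ] xs ≡ zs ++ ys)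

  Diverge : List A → List A → Set
  Diverge xs ys = ∃[ C ] ∃[ x ] ∃[ y ] ∃[ B ] ∃[ B′ ] x ≢ y × xs ≡ C ++ x ∷ B × ys ≡ C ++ y ∷ B′

  prefix-comparable-or-diverge : DecidableEquality A → ∀ xs ys → PrefixComparable xs ys ⊎ Diverge xs ys
  prefix-comparable-or-diverge _≟_ [] ys = inj₁ (inj₁ (ys , refl))
  prefix-comparable-or-diverge _≟_ (x ∷ xs) [] = inj₁ (inj₂ (x ∷ xs , refl))
  prefix-comparable-or-diverge _≟_ (x ∷ xs) (y ∷ ys) with x ≟ y
  ... | no x≢y = inj₂ ([] , x , y , xs , ys , x≢y , refl , refl)
  ... | yes refl with prefix-comparable-or-diverge _≟_ xs ys
  ... | inj₁ (inj₁ (zs , eq)) = inj₁ (inj₁ (zs , cong (x ∷_) eq))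
  ... | inj₁ (inj₂ (zs , eq)) = inj₁ (inj₂ (zs , cong (x ∷_) eq))
  ... | inj₂ (C , a , b , B , B′ , a≢b , p , q) = inj₂ (x ∷ C , a , b , B , B′ , a≢b , cong (x ∷_) p , cong (x ∷_) q)

  private
    unreverse : ∀ (xs ys zs : List A) → reverse xs ≡ reverse ys ++ zs → xs ≡ reverse zs ++ ys
    unreverse xs ys zs eq = trans (sym (reverse-selfInverse eq))
      (trans (reverse-++ (reverse ys) zs) (cong (reverse zs ++_) (reverse-involutive ys)))

  reverse-++-∷ : ∀ (X : List A) a Y → reverse (X ++ a ∷ Y) ≡ reverse Y ++ a ∷ reverse X
  reverse-++-∷ X a Y = trans (reverse-++ X (a ∷ Y))
    (trans (cong (_++ reverse X) (unfold-reverse a Y)) (++-assoc (reverse Y) [ a ] (reverse X)))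

  reverse-++-∷-++-∷ : ∀ (X : List A) a Y b Z →
    reverse (X ++ a ∷ Y ++ b ∷ Z) ≡ reverse Z ++ b ∷ reverse Y ++ a ∷ reverse X
  reverse-++-∷-++-∷ X a Y b Z = trans (reverse-++-∷ X a (Y ++ b ∷ Z))
    (trans (cong (_++ a ∷ reverse X) (reverse-++-∷ Y b Z))
           (++-assoc (reverse Z) (b ∷ reverse Y) (a ∷ reverse X)))

  PrefixComparable-reverse : ∀ {xs ys : List A} → PrefixComparable (reverse xs) (reverse ys) → SuffixComparable xs ys
  PrefixComparable-reverse {xs} {ys} (inj₁ (zs , eq)) = inj₁ (reverse zs , unreverse ys xs zs eq)
  PrefixComparable-reverse {xs} {ys} (inj₂ (zs , eq)) = inj₂ (reverse zs , unreverse xs ys zs eq)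

  reverse-≢[] : ∀ {xs : List A} → xs ≢ [] → reverse xs ≢ []
  reverse-≢[] xs≢[] eq = xs≢[] (reverse-injective eq)

  Unique-reverse : ∀ {xs : List A} → Unique xs → Unique (reverse xs)
  Unique-reverse {xs} = Perm.Unique-resp-↭ (setoid A) (Perm.↭-sym (setoid A) (Perm.↭-reverse (setoid A) xs))

module _ {m : ℕ} {P : Pred (Fin m) 0ℓ} (P? : Decidable P) where

  1<count⇒another : 1 < length (filter P? (allFin m)) → ∀ a → ∃[ b ] b ≢ a × P b
  1<count⇒another 1<c a with member-other-than _≟_ (filter⁺ P? {allFin m} (allFin⁺ m)) 1<c a
  ... | b , b≢a , b∈ = b , b≢a , proj₂ (∈-filter⁻ P? {xs = allFin m} b∈)

  count≤1⇒unique : ¬ (1 < length (filter P? (allFin m))) → ∀ {a b} → P a → P b → a ≡ b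
  count≤1⇒unique c≤1 {a} {b} pa pb with a ≟ b
  ... | yes a≡b = a≡b
  ... | no a≢b = ⊥-elim (c≤1 (distinct-members⇒1<length
          (∈-filter⁺ P? {xs = allFin m} (∈-allFin a) pa) (∈-filter⁺ P? {xs = allFin m} (∈-allFin b) pb) a≢b))

-- Reversing every arc swaps indeg and outdeg definitionally, so JoinArc G e and
-- SplitArc (reverseGraph G) e are the same type; every fact about left wings below
-- is the reversal of the corresponding fact about right wings.
reverseGraph : Graph → Graph
reverseGraph G = record { n = Graph.n G ; m = Graph.m G ; tl = Graph.hd G ; hd = Graph.tl G }

module Degrees (G : Graph) where
  open Graph G

  out-arc-unique : ∀ {v a b} → ¬ SplitNode G v → tl a ≡ v → tl b ≡ v → a ≡ b
  out-arc-unique {v} ¬split = count≤1⇒unique (λ e → tl e ≟ v) ¬split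

  another-out-arc : ∀ {g} → SplitArc G g → ∃[ g′ ] g′ ≢ g × tl g′ ≡ tl g
  another-out-arc {g} split = 1<count⇒another (λ e → tl e ≟ tl g) split g

  ¬join⇒split : Compressed G → ∀ v → ¬ JoinNode G v → SplitNode G v
  ¬join⇒split (noBiunivocalNode , _) v ¬join with 1 <? outdeg G v
  ... | yes split = split
  ... | no ¬split = ⊥-elim (noBiunivocalNode v (¬join , ¬split))

module Walks (G : Graph) where
  open Graph G
  open import Data.List.Membership.DecPropositional (_≟_ {n}) using (_∈?_)

  Walk : Node G → Node G → List (Arc G) → Set
  Walk u w [] = u ≡ w
  Walk u w (e ∷ P) = tl e ≡ u × Walk (hd e) w P

  Walk-++ : ∀ {u v w} P {Q} → Walk u v P → Walk v w Q → Walk u w (P ++ Q)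
  Walk-++ [] refl wQ = wQ
  Walk-++ (e ∷ P) (te , wP) wQ = te , Walk-++ P wP wQ

  Walk-++⁻ : ∀ {u w} P {Q} → Walk u w (P ++ Q) → ∃[ v ] Walk u v P × Walk v w Q
  Walk-++⁻ [] wQ = _ , refl , wQ
  Walk-++⁻ (e ∷ P) (te , wPQ) with Walk-++⁻ P wPQ
  ... | v , wP , wQ = v , (te , wP) , wQ

  Walk-end-unique : ∀ {u v v′} P → Walk u v P → Walk u v′ P → v ≡ v′
  Walk-end-unique [] refl refl = refl
  Walk-end-unique (e ∷ P) (refl , wP) (refl , wP′) = Walk-end-unique P wP wP′

  IsWalk-++⁻ : ∀ X Y → IsWalk G (X ++ Y) → IsWalk G X × IsWalk G Y
  IsWalk-++⁻ [] Y wY = _ , wY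
  IsWalk-++⁻ (x ∷ []) [] _ = _ , _
  IsWalk-++⁻ (x ∷ []) (y ∷ Y) (_ , wY) = _ , wY
  IsWalk-++⁻ (x ∷ x′ ∷ X) Y (hx , w) with IsWalk-++⁻ (x′ ∷ X) Y w
  ... | wX , wY = (hx , wX) , wY

  Walk⇒IsWalk : ∀ {u w} P → Walk u w P → IsWalk G P
  Walk⇒IsWalk [] _ = _
  Walk⇒IsWalk (e ∷ []) _ = _
  Walk⇒IsWalk (e ∷ e′ ∷ P) (_ , te′ , wP) = sym te′ , Walk⇒IsWalk (e′ ∷ P) (te′ , wP)

  IsWalk⇒Walk : ∀ e P → IsWalk G (e ∷ P) → ∃[ w ] Walk (tl e) w (e ∷ P)
  IsWalk⇒Walk e [] _ = hd e , refl , refl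
  IsWalk⇒Walk e (e′ ∷ P) (he , wP) with IsWalk⇒Walk e′ P wP
  ... | w , te′ , walk = w , refl , trans te′ (sym he) , walk

  Walk⇒last : ∀ {u w} e P → Walk u w (e ∷ P) → ∃[ ys ] ∃[ l ] e ∷ P ≡ ys ++ [ l ] × hd l ≡ w
  Walk⇒last e [] (_ , hl) = [] , e , refl , hl
  Walk⇒last e (e′ ∷ P) (_ , wP) with Walk⇒last e′ P wP
  ... | ys , l , eq , hl = e ∷ ys , l , cong (e ∷_) eq , hl

  Walk⇒WalkFromTo : ∀ {u v} P → Walk u v P → WalkFromTo G u v P
  Walk⇒WalkFromTo [] refl = _ , inj₁ (refl , refl)
  Walk⇒WalkFromTo (e ∷ P) wP with Walk⇒last e P wP
  ... | ys , l , eq , hl = Walk⇒IsWalk (e ∷ P) wP , inj₂ (e , l , (P , ys , refl , eq) , proj₁ wP , hl)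

  walk-between : StronglyConnected G → ∀ u v → ∃[ P ] Walk u v P
  walk-between sc u v with sc u v
  ... | _ , _ , inj₁ (refl , refl) = [] , refl
  ... | _ , wP , inj₂ (f , l , (xs , ys , refl , eq) , refl , refl) with IsWalk⇒Walk f xs wP
  ... | w , walk with Walk⇒last f xs walk
  ... | ys′ , l′ , eq′ , refl with ∷ʳ-injective ys ys′ (trans (sym eq) eq′)
  ... | _ , refl = f ∷ xs , walk

  NodeSimple : Node G → List (Arc G) → Set
  NodeSimple u Q = Unique (u ∷ map hd Q)

  tails-visited : ∀ {u w x} Q → Walk u w Q → x ∈ map tl Q → x ∈ u ∷ map hd Q
  tails-visited (e ∷ Q) (te , _) (here refl) = here te
  tails-visited (e ∷ Q) (_ , wQ) (there x∈) = there (tails-visited Q wQ x∈)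

  end-visited : ∀ {u w} Q → Walk u w Q → w ∈ u ∷ map hd Q
  end-visited [] refl = here refl
  end-visited (e ∷ Q) (_ , wQ) = there (end-visited Q wQ)

  NodeSimple⇒end∉tails : ∀ {u w} Q → Walk u w Q → NodeSimple u Q → w ∉ map tl Q
  NodeSimple⇒end∉tails (e ∷ Q) (te , wQ) simple (here refl) =
    Unique[x∷xs]⇒x∉xs simple (subst (_∈ _) te (end-visited Q wQ))
  NodeSimple⇒end∉tails (e ∷ Q) (_ , wQ) simple (there w∈) =
    NodeSimple⇒end∉tails Q wQ (Unique-tail simple) w∈

  NodeSimple⇒Unique-tails : ∀ {u w} Q → Walk u w Q → NodeSimple u Q → Unique (map tl Q)
  NodeSimple⇒Unique-tails [] _ _ = []
  NodeSimple⇒Unique-tails (e ∷ Q) (te , wQ) simple =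
    ∉⇒Unique-∷ (λ t∈ → Unique[x∷xs]⇒x∉xs simple (subst (_∈ _) te (tails-visited Q wQ t∈)))
      (NodeSimple⇒Unique-tails Q wQ (Unique-tail simple))

  visited-suffix : ∀ {u w v} Q → Walk u w Q → NodeSimple u Q → v ∈ u ∷ map hd Q →
    ∃[ Q′ ] Walk v w Q′ × NodeSimple v Q′
  visited-suffix Q wQ simple (here refl) = Q , wQ , simple
  visited-suffix (e ∷ Q) (_ , wQ) simple (there v∈) = visited-suffix Q wQ (Unique-tail simple) v∈

  shortcut : ∀ {u w} P → Walk u w P → ∃[ Q ] Walk u w Q × NodeSimple u Q
  shortcut [] refl = [] , refl , [] ∷ []
  shortcut {u} (e ∷ P) (te , wP) with shortcut P wP
  ... | Q , wQ , simple with u ∈? hd e ∷ map hd Q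
  ...   | yes u∈ = visited-suffix Q wQ simple u∈
  ...   | no u∉ = e ∷ Q , (te , wQ) , ∉⇒Unique-∷ u∉ simple

  PathFromTo : Node G → Node G → List (Arc G) → Arc G → Arc G → Set
  PathFromTo u w P p l = IsPath G P × FirstLast G P p l × tl p ≡ u × hd l ≡ w

  path-∷ : ∀ {w} a Q → Walk (hd a) w Q → NodeSimple (hd a) Q → tl a ∉ map tl Q →
    ∃[ l ] PathFromTo (tl a) w (a ∷ Q) a l
  path-∷ a Q wQ simple t∉ with Walk⇒last a Q (refl , wQ)
  ... | ys , l , eq , hl =
    l , (Walk⇒IsWalk (a ∷ Q) (refl , wQ) , ∉⇒Unique-∷ t∉ (NodeSimple⇒Unique-tails Q wQ simple) , simple) ,
    (Q , ys , refl , eq) , refl , hl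

  path-tail : ∀ {u w c p xs l} → PathFromTo u w (c ∷ p ∷ xs) c l → PathFromTo (hd c) w (p ∷ xs) p l
  path-tail (((hc , wP) , _ ∷ ut , _ ∷ uh) , (_ , y ∷ ys , _ , eq) , _ , hl) =
    (wP , ut , uh) , (_ , ys , refl , proj₂ (∷-injective eq)) , sym hc , hl
  path-tail (_ , (_ , [] , _ , ()) , _)

  single-arc-path : ∀ {u w c l} → PathFromTo u w [ c ] c l → l ≡ c
  single-arc-path (_ , (_ , [] , _ , refl) , _) = refl
  single-arc-path (_ , (_ , _ ∷ _ ∷ _ , _ , ()) , _)


module Omnitigs (G : Graph) where
  open Graph G
  open Walks G

  omnitig-blocks : ∀ {W} → IsOmnitig G W → ∀ X a Y b Z → W ≡ X ++ a ∷ Y ++ b ∷ Z →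
    ∀ {P p l} → PathFromTo (tl b) (hd a) P p l → p ≢ b → l ≢ a → ⊥
  omnitig-blocks (_ , _ , om) X a Y b Z eq {P} {p} {l} (isPath , fl , tp , hl) p≢b l≢a =
    om X a Y b Z eq (P , p , l , isPath , fl , tp , hl , p≢b , l≢a)

  IsOmnitig-suffix : ∀ X Y → Y ≢ [] → IsOmnitig G (X ++ Y) → IsOmnitig G Y
  IsOmnitig-suffix X Y Y≢[] (w , _ , om) = proj₂ (IsWalk-++⁻ X Y w) , Y≢[] ,
    λ X′ a Y′ b Z eq → om (X ++ X′) a Y′ b Z (trans (cong (X ++_) eq) (sym (++-assoc X X′ _)))

  IsOmnitig-prefix : ∀ X Y → X ≢ [] → IsOmnitig G (X ++ Y) → IsOmnitig G X
  IsOmnitig-prefix X Y X≢[] (w , _ , om) = proj₁ (IsWalk-++⁻ X Y w) , X≢[] ,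
    λ X′ a Y′ b Z eq → om X′ a Y′ b (Z ++ Y) (trans (cong (_++ Y) eq) (reassoc X′ a Y′ b Z))
    where
    reassoc : ∀ X′ a Y′ b Z → (X′ ++ a ∷ Y′ ++ b ∷ Z) ++ Y ≡ X′ ++ a ∷ Y′ ++ b ∷ (Z ++ Y)
    reassoc X′ a Y′ b Z = trans (++-assoc X′ (a ∷ Y′ ++ b ∷ Z) Y) (cong (λ z → X′ ++ a ∷ z) (++-assoc Y′ (b ∷ Z) Y))

  NoInternalBivalent-suffix : ∀ X Y → NoInternalBivalent G (X ++ Y) → NoInternalBivalent G Y
  NoInternalBivalent-suffix X Y noBiv X′ a Y′ eq X′≢[] =
    noBiv (X ++ X′) a Y′ (trans (cong (X ++_) eq) (sym (++-assoc X X′ _))) (λ e → X′≢[] (++-conicalʳ X X′ e))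

  NoInternalBivalent-prefix : ∀ X Y → NoInternalBivalent G (X ++ Y) → NoInternalBivalent G X
  NoInternalBivalent-prefix X Y noBiv X′ a Y′ eq X′≢[] Y′≢[] =
    noBiv X′ a (Y′ ++ Y) (trans (cong (_++ Y) eq) (++-assoc X′ (a ∷ Y′) Y)) X′≢[] (λ e → Y′≢[] (++-conicalˡ Y′ Y e))

  LeftMicro-suffix : ∀ Z W {f g} → LeftMicro G (Z ++ W) f g → LeftMicro G W f g
  LeftMicro-suffix Z W {f} {g} (om , central , noBiv) =
    IsOmnitig-suffix Z (W ++ f ∷ g ∷ []) (λ e → case ++-conicalʳ W _ e of λ ())
      (subst (IsOmnitig G) (++-assoc Z W _) om) ,
    central , NoInternalBivalent-suffix Z (W ++ f ∷ g ∷ []) (subst (NoInternalBivalent G) (++-assoc Z W _) noBiv)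

  RightMicro-prefix : ∀ W Z {f g} → RightMicro G f g (W ++ Z) → RightMicro G f g W
  RightMicro-prefix W Z {f} {g} (om , central , noBiv) =
    IsOmnitig-prefix (f ∷ g ∷ W) Z (λ ()) om , central , NoInternalBivalent-prefix (f ∷ g ∷ W) Z noBiv


module WalkReversal (G : Graph) where
  open Graph G
  open Walks G
  private
    G′ : Graph
    G′ = reverseGraph G
    module W′ = Walks G′

  Walk-reverse : ∀ {u w} P → Walk u w P → W′.Walk w u (reverse P)
  Walk-reverse [] refl = refl
  Walk-reverse {u} {w} (e ∷ P) (te , wP) = subst (W′.Walk w u) (sym (unfold-reverse e P))
    (W′.Walk-++ (reverse P) (Walk-reverse P wP) (refl , te))

  IsWalk-reverse : ∀ P → IsWalk G P → IsWalk G′ (reverse P)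
  IsWalk-reverse [] _ = _
  IsWalk-reverse (e ∷ P) wP = W′.Walk⇒IsWalk (reverse (e ∷ P)) (Walk-reverse (e ∷ P) (proj₂ (IsWalk⇒Walk e P wP)))

  FirstLast-reverse : ∀ {P p l} → FirstLast G P p l → FirstLast G′ (reverse P) l p
  FirstLast-reverse {P} {p} {l} (xs , ys , refl , eq) =
    reverse ys , reverse xs , trans (cong reverse eq) (reverse-++ ys [ l ]) , unfold-reverse p xs

  IsPath-reverse : ∀ {P} → IsPath G P → IsPath G′ (reverse P)
  IsPath-reverse {P} (wP , uniqueTails , uniqueHeads) = IsWalk-reverse P wP ,
    subst Unique (sym (reverse-map hd P)) (Unique-reverse uniqueHeads) ,
    subst Unique (sym (reverse-map tl P)) (Unique-reverse uniqueTails)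

  PathFromTo-reverse : ∀ {u w P p l} → PathFromTo u w P p l → W′.PathFromTo w u (reverse P) l p
  PathFromTo-reverse (isPath , fl , tp , hl) = IsPath-reverse isPath , FirstLast-reverse fl , hl , tp

  StronglyConnected-reverse : StronglyConnected G → StronglyConnected G′
  StronglyConnected-reverse sc u v with walk-between sc v u
  ... | P , wP = reverse P , W′.Walk⇒WalkFromTo (reverse P) (Walk-reverse P wP)

  Compressed-reverse : Compressed G → Compressed G′
  Compressed-reverse (noBiunivocalNode , noBiunivocalArc) =
    (λ v (¬split , ¬join) → noBiunivocalNode v (¬join , ¬split)) ,
    (λ e (¬split , ¬join) → noBiunivocalArc e (¬join , ¬split))

module Reversal (G : Graph) where
  open Graph G
  open WalkReversal G
  private
    G′ : Graph
    G′ = reverseGraph G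
    module R′ = WalkReversal G′

  IsOmnitig-reverse : ∀ {W} → IsOmnitig G W → IsOmnitig G′ (reverse W)
  IsOmnitig-reverse {W} (wW , W≢[] , om) = IsWalk-reverse W wW , reverse-≢[] W≢[] ,
    λ { X a Y b Z eq (P , p , l , isPath , fl , tp , hl , p≢b , l≢a) →
      om (reverse Z) b (reverse Y) a (reverse X)
        (trans (sym (reverse-selfInverse eq)) (reverse-++-∷-++-∷ X a Y b Z))
        (reverse P , l , p , R′.IsPath-reverse isPath , R′.FirstLast-reverse fl , hl , tp , l≢a , p≢b) }

  NoInternalBivalent-reverse : ∀ {W} → NoInternalBivalent G W → NoInternalBivalent G′ (reverse W)
  NoInternalBivalent-reverse noBiv X a Y eq X≢[] Y≢[] (split , join) =
    noBiv (reverse Y) a (reverse X) (trans (sym (reverse-selfInverse eq)) (reverse-++-∷ X a Y))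
      (reverse-≢[] Y≢[]) (reverse-≢[] X≢[]) (join , split)

  CentralMicro-reverse : ∀ {f g} → CentralMicro G f g → CentralMicro G′ g f
  CentralMicro-reverse (om , join , split) = IsOmnitig-reverse om , split , join

  LeftMicro-reverse : ∀ {W f g} → LeftMicro G W f g → RightMicro G′ g f (reverse W)
  LeftMicro-reverse {W} {f} {g} (om , central , noBiv) =
    subst (IsOmnitig G′) (reverse-++-∷ W f [ g ]) (IsOmnitig-reverse om) , CentralMicro-reverse central ,
    subst (NoInternalBivalent G′) (reverse-++-∷ W f [ g ]) (NoInternalBivalent-reverse noBiv)

  RightMicro-reverse : ∀ {W f g} → RightMicro G f g W → LeftMicro G′ (reverse W) g f
  RightMicro-reverse {W} {f} {g} (om , central , noBiv) =
    subst (IsOmnitig G′) (reverse-++-∷ [ f ] g W) (IsOmnitig-reverse om) , CentralMicro-reverse central ,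
    subst (NoInternalBivalent G′) (reverse-++-∷ [ f ] g W) (NoInternalBivalent-reverse noBiv)

  IsMicrotig-reverse : ∀ {M} → IsMicrotig G M → IsMicrotig G′ (reverse M)
  IsMicrotig-reverse (W₁ , f , g , W₂ , refl , left , right) =
    reverse W₂ , g , f , reverse W₁ , reverse-++-∷-++-∷ W₁ f [] g W₂ ,
    RightMicro-reverse right , LeftMicro-reverse left

MaximalMicrotig-reverse : ∀ G {M} → MaximalMicrotig G M → MaximalMicrotig (reverseGraph G) (reverse M)
MaximalMicrotig-reverse G {M} (micro , ¬prepend , ¬append) = R.IsMicrotig-reverse micro ,
  (λ a micro′ → ¬append a (subst (IsMicrotig G)
      (trans (unfold-reverse a (reverse M)) (cong (_++ [ a ]) (reverse-involutive M))) (R′.IsMicrotig-reverse micro′))) ,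
  (λ a micro′ → ¬prepend a (subst (IsMicrotig G)
      (trans (reverse-++ (reverse M) [ a ]) (cong (a ∷_) (reverse-involutive M))) (R′.IsMicrotig-reverse micro′)))
  where
  module R = Reversal G
  module R′ = Reversal (reverseGraph G)

module CentralArcs (G : Graph) (sc : StronglyConnected G) where
  open Graph G
  open Walks G
  open Degrees G
  open Omnitigs G

  -- Leave t(g) by another arc g′ and return along a node-simple walk, which
  -- cannot pass through t(g) before its end.
  closed-path-leaving : ∀ {g} → SplitArc G g → ∃[ P ] ∃[ p ] ∃[ l ] PathFromTo (tl g) (tl g) P p l × p ≢ g
  closed-path-leaving {g} split with another-out-arc split
  ... | g′ , g′≢g , tg′ with walk-between sc (hd g′) (tl g)
  ... | P , wP with shortcut P wP
  ... | Q , wQ , simple with path-∷ g′ Q wQ simple (subst (_∉ map tl Q) (sym tg′) (NodeSimple⇒end∉tails Q wQ simple))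
  ... | l , (isPath , fl , _ , hl) = g′ ∷ Q , g′ , l , (isPath , fl , tg′ , hl) , g′≢g

  closing-arc : ∀ {f g P p l} → CentralMicro G f g → PathFromTo (tl g) (tl g) P p l → p ≢ g → l ≡ f
  closing-arc {f} {g} {l = l} (om , _) (isPath , fl , tp , hl) p≢g with l ≟ f
  ... | yes l≡f = l≡f
  ... | no l≢f = ⊥-elim (omnitig-blocks om [] f [] g [] refl
                          (isPath , fl , tp , trans hl (sym (proj₁ (proj₁ om)))) p≢g l≢f)

  central-join-unique : ∀ {f f′ g} → CentralMicro G f g → CentralMicro G f′ g → f ≡ f′
  central-join-unique central central′ with closed-path-leaving (proj₂ (proj₂ central))
  ... | _ , _ , _ , path , p≢g = trans (sym (closing-arc central path p≢g)) (closing-arc central′ path p≢g)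

module RightWings (G : Graph) (sc : StronglyConnected G) (comp : Compressed G) where
  open Graph G
  open Walks G
  open Degrees G
  open Omnitigs G
  private
    module C′ = CentralArcs (reverseGraph G) (WalkReversal.StronglyConnected-reverse G sc)
    module R′ = WalkReversal (reverseGraph G)

  PathIntoAvoiding : Node G → Arc G → Set
  PathIntoAvoiding u f = ∃[ P ] ∃[ p ] ∃[ l ] PathFromTo u (hd f) P p l × l ≢ f

  closed-path-entering : ∀ {f} → JoinArc G f → PathIntoAvoiding (hd f) f
  closed-path-entering join with C′.closed-path-leaving join
  ... | P , p , l , path , p≢f = reverse P , l , p , R′.PathFromTo-reverse path , p≢f

  splits-propagate : ∀ X c L → X ≢ [] → IsWalk G (c ∷ L) → NoInternalBivalent G (X ++ c ∷ L) →
    SplitArc G c → All (SplitArc G) (c ∷ L)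
  splits-propagate X c [] _ _ _ split = split ∷ []
  splits-propagate X c (d ∷ L) X≢[] (hc , wL) noBiv split = split ∷ splits-propagate (X ++ [ c ]) d L
    (∷ʳ-≢[] X c) wL
    (subst (NoInternalBivalent G) (sym (++-assoc X [ c ] (d ∷ L))) noBiv)
    (subst (SplitNode G) hc (¬join⇒split comp (hd c) (λ join → noBiv X c (d ∷ L) refl X≢[] (λ ()) (join , split))))

  right-wing-splits : ∀ {f g W} → RightMicro G f g W → All (SplitArc G) (g ∷ W)
  right-wing-splits {f} {g} {W} ((wW , _) , (_ , _ , split) , noBiv) =
    splits-propagate [ f ] g W (λ ()) (proj₂ wW) noBiv split

  -- The omnitig condition forces the path to leave t(c) by c itself, and it cannot stop
  -- after c: then c would be a join arc, i.e. an internal bivalent arc.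
  PathIntoAvoiding-follows-splits : ∀ {f W} → IsOmnitig G (f ∷ W) → NoInternalBivalent G (f ∷ W) → JoinArc G f →
    ∀ R C T {u v} → W ≡ R ++ C ++ T → T ≢ [] → All (SplitArc G) C → Walk u v C →
    PathIntoAvoiding u f → PathIntoAvoiding v f
  PathIntoAvoiding-follows-splits om noBiv join R [] T _ _ _ refl path = path
  PathIntoAvoiding-follows-splits {f} om noBiv join R (c ∷ C) T {u} eq T≢[] (split ∷ splits) (tc , wC)
                (P , p , l , path@(isPath , fl , tp , hl) , l≢f) with p ≟ c
  ... | no p≢c = ⊥-elim (omnitig-blocks om [] f R c (C ++ T) (cong (f ∷_) eq)
                          (isPath , fl , trans tp (sym tc) , hl) p≢c l≢f)
  ... | yes refl with fl
  ...   | [] , _ , refl , _ = ⊥-elim (noBiv (f ∷ R) c (C ++ T) (cong (f ∷_) eq) (λ ())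
                              (λ e → T≢[] (++-conicalʳ C T e))
                              (subst (JoinNode G) (trans (sym hl) (cong hd (single-arc-path path))) join , split))
  ...   | p′ ∷ xs , _ , refl , _ = PathIntoAvoiding-follows-splits om noBiv join (R ++ [ c ]) C T
            (trans eq (sym (++-assoc R [ c ] (C ++ T)))) T≢[] splits wC
            (p′ ∷ xs , p′ , l , path-tail path , l≢f)

  -- A path into h(f) not ending with f is forced along g ∷ A up to t(x) = t(y), and its
  -- next arc cannot be both x and y.
  divergent-right-wings : ∀ {f g A x B y B′} → x ≢ y →
    RightMicro G f g (A ++ x ∷ B) → RightMicro G f g (A ++ y ∷ B′) → ⊥
  divergent-right-wings {f} {g} {A} {x} {B} {y} {B′} x≢y right@(om , (_ , join , _) , noBiv) (om′ , _ , _)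
    with IsWalk⇒Walk f _ (proj₁ om) | IsWalk⇒Walk f _ (proj₁ om′)
  ... | _ , _ , walk | _ , _ , walk′ with Walk-++⁻ (g ∷ A) walk | Walk-++⁻ (g ∷ A) walk′
  ... | v , wA , tx , _ | v′ , wA′ , ty , _
    with PathIntoAvoiding-follows-splits om noBiv join [] (g ∷ A) (x ∷ B) refl (λ ())
           (++⁻ˡ (g ∷ A) (right-wing-splits right)) wA (closed-path-entering join)
  ... | P , p , l , (isPath , fl , tp , hl) , l≢f with p ≟ x
  ...   | no p≢x = omnitig-blocks om [] f (g ∷ A) x B refl (isPath , fl , trans tp (sym tx) , hl) p≢x l≢f
  ...   | yes refl = omnitig-blocks om′ [] f (g ∷ A) y B′ refl
                       (isPath , fl , trans tp (trans (Walk-end-unique (g ∷ A) wA wA′) (sym ty)) , hl) x≢y l≢f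

  right-wings-comparable : ∀ {f g W W′} → RightMicro G f g W → RightMicro G f g W′ → PrefixComparable W W′
  right-wings-comparable {W = W} {W′} right right′ with prefix-comparable-or-diverge _≟_ W W′
  ... | inj₁ comparable = comparable
  ... | inj₂ (A , x , y , B , B′ , x≢y , refl , refl) = ⊥-elim (divergent-right-wings x≢y right right′)

module LeftWings (G : Graph) (sc : StronglyConnected G) (comp : Compressed G) where
  open Graph G
  open Reversal G
  private
    G′ : Graph
    G′ = reverseGraph G
    sc′ : StronglyConnected G′
    sc′ = WalkReversal.StronglyConnected-reverse G sc
    module C′ = CentralArcs G′ sc′
    module RW′ = RightWings G′ sc′ (WalkReversal.Compressed-reverse G comp)

  left-wing-joins : ∀ {W f g} → LeftMicro G W f g → All (JoinArc G) (W ++ [ f ])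
  left-wing-joins {W} {f} left = All-resp-↭ (↭-reverse (W ++ [ f ]))
    (subst (All (JoinArc G)) (sym (reverse-++ W [ f ])) (RW′.right-wing-splits (LeftMicro-reverse left)))

  left-wings-comparable : ∀ {f g W W′} → LeftMicro G W f g → LeftMicro G W′ f g → SuffixComparable W W′
  left-wings-comparable left left′ =
    PrefixComparable-reverse (RW′.right-wings-comparable (LeftMicro-reverse left) (LeftMicro-reverse left′))

  central-split-unique : ∀ {f g g′} → CentralMicro G f g → CentralMicro G f g′ → g ≡ g′
  central-split-unique central central′ =
    C′.central-join-unique (CentralMicro-reverse central) (CentralMicro-reverse central′)

module Uniqueness (G : Graph) (sc : StronglyConnected G) (comp : Compressed G) where
  open Graph G
  open Walks G
  open Degrees G
  open Omnitigs G
  open RightWings G sc comp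
  open LeftWings G sc comp

  NonSplitRun : Arc G → List (Arc G) → Set
  NonSplitRun c [] = SplitNode G (hd c)
  NonSplitRun c (y ∷ Y) = hd c ≡ tl y × ¬ SplitArc G y × NonSplitRun y Y

  NonSplitRun-unique : ∀ c Y Y′ → NonSplitRun c Y → NonSplitRun c Y′ → Y ≡ Y′
  NonSplitRun-unique c [] [] _ _ = refl
  NonSplitRun-unique c [] (y ∷ _) split (hc , ¬split , _) = ⊥-elim (¬split (subst (SplitNode G) hc split))
  NonSplitRun-unique c (y ∷ _) [] (hc , ¬split , _) split = ⊥-elim (¬split (subst (SplitNode G) hc split))
  NonSplitRun-unique c (y ∷ Y) (y′ ∷ Y′) (hc , ¬split , run) (hc′ , _ , run′)
    with out-arc-unique ¬split refl (trans (sym hc′) hc)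
  ... | refl = cong (y ∷_) (NonSplitRun-unique y Y Y′ run run′)

  joins-form-NonSplitRun : ∀ X c Y g → IsWalk G (c ∷ Y ++ [ g ]) → All (JoinArc G) Y →
    NoInternalBivalent G (X ++ c ∷ Y ++ [ g ]) → SplitArc G g → NonSplitRun c Y
  joins-form-NonSplitRun X c [] g (hc , _) _ _ split = subst (SplitNode G) (sym hc) split
  joins-form-NonSplitRun X c (y ∷ Y) g (hc , wY) (join ∷ joins) noBiv split =
    hc , (λ split′ → noBiv′ X′ y (Y ++ [ g ]) refl (∷ʳ-≢[] X c) (∷ʳ-≢[] Y g) (join , split′)) ,
    joins-form-NonSplitRun X′ y Y g wY joins noBiv′ split
    where
    X′ : List (Arc G)
    X′ = X ++ [ c ]
    noBiv′ : NoInternalBivalent G (X′ ++ y ∷ Y ++ [ g ])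
    noBiv′ = subst (NoInternalBivalent G) (sym (++-assoc X [ c ] _)) noBiv

  left-wing-run : ∀ {W₁ f g X e Y} → LeftMicro G W₁ f g → W₁ ++ [ f ] ≡ X ++ e ∷ Y → NonSplitRun e Y
  left-wing-run {W₁} {f} {g} {X} {e} {Y} left@((walk , _) , (_ , _ , split) , noBiv) eq =
    joins-form-NonSplitRun X e Y g (proj₂ (IsWalk-++⁻ X _ (subst (IsWalk G) eq′ walk))) joins
      (subst (NoInternalBivalent G) eq′ noBiv) split
    where
    eq′ : W₁ ++ f ∷ g ∷ [] ≡ X ++ e ∷ Y ++ [ g ]
    eq′ = trans (sym (++-assoc W₁ [ f ] [ g ])) (trans (cong (_++ [ g ]) eq) (++-assoc X (e ∷ Y) [ g ]))
    joins : All (JoinArc G) Y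
    joins with ++⁻ʳ X (subst (All (JoinArc G)) eq (left-wing-joins left))
    ... | _ ∷ joins = joins

  maximal-left-wing : ∀ {W₁ f g W₂} Z → MaximalMicrotig G (W₁ ++ f ∷ g ∷ W₂) →
    RightMicro G f g W₂ → LeftMicro G (Z ++ W₁) f g → Z ≡ []
  maximal-left-wing [] _ _ _ = refl
  maximal-left-wing {W₁} {f} {g} {W₂} (z ∷ Z) (_ , ¬prepend , _) right left with ∷-as-snoc z Z
  ... | ys , a , eq = ⊥-elim (¬prepend a (a ∷ W₁ , f , g , W₂ , refl ,
        LeftMicro-suffix ys (a ∷ W₁)
          (subst (λ V → LeftMicro G V f g) (trans (cong (_++ W₁) eq) (++-assoc ys [ a ] W₁)) left) ,
        right))

  maximal-right-wing : ∀ {W₁ f g W₂} Z → MaximalMicrotig G (W₁ ++ f ∷ g ∷ W₂) →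
    LeftMicro G W₁ f g → RightMicro G f g (W₂ ++ Z) → Z ≡ []
  maximal-right-wing [] _ _ _ = refl
  maximal-right-wing {W₁} {f} {g} {W₂} (a ∷ Z) (_ , _ , ¬append) left right =
    ⊥-elim (¬append a (W₁ , f , g , W₂ ++ [ a ] , ++-assoc W₁ (f ∷ g ∷ W₂) [ a ] , left ,
      RightMicro-prefix (W₂ ++ [ a ]) Z (subst (RightMicro G f g) (sym (++-assoc W₂ [ a ] Z)) right)))

  maximal-microtig-determined-by-centre : ∀ {W₁ W₁′ f g W₂ W₂′} →
    MaximalMicrotig G (W₁ ++ f ∷ g ∷ W₂) → MaximalMicrotig G (W₁′ ++ f ∷ g ∷ W₂′) →
    LeftMicro G W₁ f g → RightMicro G f g W₂ → LeftMicro G W₁′ f g → RightMicro G f g W₂′ →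
    W₁ ++ f ∷ g ∷ W₂ ≡ W₁′ ++ f ∷ g ∷ W₂′
  maximal-microtig-determined-by-centre {W₁} {W₁′} {f} {g} {W₂} {W₂′} max max′ left right left′ right′ =
    cong₂ (λ V₁ V₂ → V₁ ++ f ∷ g ∷ V₂) same-left same-right
    where
    same-left : W₁ ≡ W₁′
    same-left with left-wings-comparable left left′
    ... | inj₁ (Z , eq) = sym (trans eq (cong (_++ W₁)
            (maximal-left-wing Z max right (subst (λ V → LeftMicro G V f g) eq left′))))
    ... | inj₂ (Z , eq) = trans eq (cong (_++ W₁′)
            (maximal-left-wing Z max′ right′ (subst (λ V → LeftMicro G V f g) eq left)))
    same-right : W₂ ≡ W₂′
    same-right with right-wings-comparable right right′
    ... | inj₁ (Z , eq) = sym (trans eq (trans (cong (W₂ ++_)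
            (maximal-right-wing Z max left (subst (RightMicro G f g) eq right′))) (++-identityʳ W₂)))
    ... | inj₂ (Z , eq) = trans eq (trans (cong (W₂′ ++_)
            (maximal-right-wing Z max′ left′ (subst (RightMicro G f g) eq right))) (++-identityʳ W₂′))

  leftWing : ∀ {M} → IsMicrotig G M → List (Arc G)
  leftWing (W₁ , f , _) = W₁ ++ [ f ]

  maximal-microtig-determined-by-left-wing-arc : ∀ {M M′} (max : MaximalMicrotig G M) (max′ : MaximalMicrotig G M′) →
    ∀ {X e Y X′ Y′} → leftWing (proj₁ max) ≡ X ++ e ∷ Y → leftWing (proj₁ max′) ≡ X′ ++ e ∷ Y′ → M ≡ M′
  maximal-microtig-determined-by-left-wing-arc
    max@((W₁ , f , g , W₂ , refl , left , right) , _) max′@((W₁′ , f′ , g′ , W₂′ , refl , left′ , right′) , _) eq eq′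
    with NonSplitRun-unique _ _ _ (left-wing-run left eq) (left-wing-run left′ eq′)
  ... | refl with last-determined eq eq′
  ... | refl with central-split-unique (proj₁ (proj₂ left)) (proj₁ (proj₂ left′))
  ... | refl = maximal-microtig-determined-by-centre max max′ left right left′ right′

  non-split-arc-in-left-wing : ∀ {M e} (micro : IsMicrotig G M) → ¬ SplitArc G e → e ∈ M → e ∈ leftWing micro
  non-split-arc-in-left-wing (W₁ , f , g , W₂ , refl , _ , right) ¬split e∈M
    with ∈-++⁻ (W₁ ++ [ f ]) (subst (_ ∈_) (sym (++-assoc W₁ [ f ] (g ∷ W₂))) e∈M)
  ... | inj₁ e∈wing = e∈wing
  ... | inj₂ e∈right = ⊥-elim (¬split (All.lookup (right-wing-splits right) e∈right))

  non-split-arc-in-unique-maximal : ∀ {e} → ¬ SplitArc G e →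
    ∀ M M′ → MaximalMicrotig G M → e ∈ M → MaximalMicrotig G M′ → e ∈ M′ → M ≡ M′
  non-split-arc-in-unique-maximal ¬split _ _ max e∈M max′ e∈M′
    with ∈-∃++ (non-split-arc-in-left-wing (proj₁ max) ¬split e∈M)
       | ∈-∃++ (non-split-arc-in-left-wing (proj₁ max′) ¬split e∈M′)
  ... | _ , _ , eq | _ , _ , eq′ = maximal-microtig-determined-by-left-wing-arc max max′ eq eq′

  first-arc-in-left-wing : ∀ {e W} (micro : IsMicrotig G (e ∷ W)) → ∃[ Y ] leftWing micro ≡ [] ++ e ∷ Y
  first-arc-in-left-wing ([] , _ , _ , _ , refl , _) = [] , refl
  first-arc-in-left-wing (_ ∷ W₁ , f , _ , _ , refl , _) = W₁ ++ [ f ] , refl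

  maximal-starting-at-unique : ∀ e W W′ → MaximalMicrotig G (e ∷ W) → MaximalMicrotig G (e ∷ W′) → W ≡ W′
  maximal-starting-at-unique e _ _ max max′
    with first-arc-in-left-wing (proj₁ max) | first-arc-in-left-wing (proj₁ max′)
  ... | _ , eq | _ , eq′ =
    ∷-injectiveʳ (maximal-microtig-determined-by-left-wing-arc max max′ {X = []} {X′ = []} eq eq′)

  bivalent-arc-at-an-end : ∀ {e M} → BivalentArc G e → IsMicrotig G M → e ∈ M →
    (∃[ W ] M ≡ e ∷ W) ⊎ (∃[ W ] M ≡ W ++ [ e ])
  bivalent-arc-at-an-end {e} bivalent (W₁ , f , g , W₂ , refl , (_ , _ , noBivˡ) , (_ , _ , noBivʳ)) e∈M
    with ∈-++⁻ (W₁ ++ [ f ]) (subst (_ ∈_) (sym (++-assoc W₁ [ f ] (g ∷ W₂))) e∈M)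
  ... | inj₁ e∈wing with ∈-∃++ e∈wing
  ...   | [] , Y , eq = inj₁ (Y ++ g ∷ W₂ , trans (sym (++-assoc W₁ [ f ] (g ∷ W₂))) (cong (_++ g ∷ W₂) eq))
  ...   | X@(_ ∷ _) , Y , eq = ⊥-elim (noBivˡ X e (Y ++ [ g ])
          (trans (sym (++-assoc W₁ [ f ] [ g ])) (trans (cong (_++ [ g ]) eq) (++-assoc X (e ∷ Y) [ g ])))
          (λ ()) (∷ʳ-≢[] Y g) bivalent)
  bivalent-arc-at-an-end {e} bivalent (W₁ , f , g , W₂ , refl , _ , (_ , _ , noBivʳ)) e∈M
      | inj₂ e∈right with ∈-∃++ e∈right
  ...   | X , [] , eq = inj₂ (W₁ ++ f ∷ X , trans (cong (λ V → W₁ ++ f ∷ V) eq) (sym (++-assoc W₁ (f ∷ X) [ e ])))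
  ...   | X , Y@(_ ∷ _) , eq = ⊥-elim (noBivʳ (f ∷ X) e Y (cong (f ∷_) eq) (λ ()) (λ ()) bivalent)

module MaximalMicrotigs (G : Graph) (sc : StronglyConnected G) (comp : Compressed G) where
  open Uniqueness G sc comp public
  private
    G′ : Graph
    G′ = reverseGraph G
    module U′ = Uniqueness G′ (WalkReversal.StronglyConnected-reverse G sc) (WalkReversal.Compressed-reverse G comp)

  non-join-arc-in-unique-maximal : ∀ {e} → ¬ JoinArc G e →
    ∀ M M′ → MaximalMicrotig G M → e ∈ M → MaximalMicrotig G M′ → e ∈ M′ → M ≡ M′
  non-join-arc-in-unique-maximal ¬join M M′ max e∈M max′ e∈M′ = reverse-injective
    (U′.non-split-arc-in-unique-maximal ¬join (reverse M) (reverse M′)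
      (MaximalMicrotig-reverse G max) (reverse⁺ e∈M) (MaximalMicrotig-reverse G max′) (reverse⁺ e∈M′))

  maximal-ending-at-unique : ∀ e W W′ → MaximalMicrotig G (W ++ [ e ]) → MaximalMicrotig G (W′ ++ [ e ]) → W ≡ W′
  maximal-ending-at-unique e W W′ max max′ =
    reverse-injective (U′.maximal-starting-at-unique e (reverse W) (reverse W′)
      (subst (MaximalMicrotig G′) (reverse-++ W [ e ]) (MaximalMicrotig-reverse G max))
      (subst (MaximalMicrotig G′) (reverse-++ W′ [ e ]) (MaximalMicrotig-reverse G max′)))

  at-most-two-maximal-through-bivalent : ∀ {e} → BivalentArc G e → ∀ M₁ M₂ M₃ →
    MaximalMicrotig G M₁ → e ∈ M₁ → MaximalMicrotig G M₂ → e ∈ M₂ → MaximalMicrotig G M₃ → e ∈ M₃ →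
    M₁ ≡ M₂ ⊎ M₁ ≡ M₃ ⊎ M₂ ≡ M₃
  at-most-two-maximal-through-bivalent {e} bivalent M₁ M₂ M₃ max₁ e∈M₁ max₂ e∈M₂ max₃ e∈M₃ =
    pigeonhole (end max₁ e∈M₁) (end max₂ e∈M₂) (end max₃ e∈M₃)
    where
    End : List (Arc G) → Set
    End M = (∃[ W ] M ≡ e ∷ W) ⊎ (∃[ W ] M ≡ W ++ [ e ])
    end : ∀ {M} → MaximalMicrotig G M → e ∈ M → End M
    end max = bivalent-arc-at-an-end bivalent (proj₁ max)
    at-front : ∀ {M N} → MaximalMicrotig G M → MaximalMicrotig G N → ∃[ W ] M ≡ e ∷ W → ∃[ W ] N ≡ e ∷ W → M ≡ N
    at-front max max′ (W , refl) (W′ , refl) = cong (e ∷_) (maximal-starting-at-unique e W W′ max max′)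
    at-back : ∀ {M N} → MaximalMicrotig G M → MaximalMicrotig G N →
      ∃[ W ] M ≡ W ++ [ e ] → ∃[ W ] N ≡ W ++ [ e ] → M ≡ N
    at-back max max′ (W , refl) (W′ , refl) = cong (_++ [ e ]) (maximal-ending-at-unique e W W′ max max′)
    pigeonhole : End M₁ → End M₂ → End M₃ → M₁ ≡ M₂ ⊎ M₁ ≡ M₃ ⊎ M₂ ≡ M₃
    pigeonhole (inj₁ front₁) (inj₁ front₂) _ = inj₁ (at-front max₁ max₂ front₁ front₂)
    pigeonhole (inj₂ back₁) (inj₂ back₂) _ = inj₁ (at-back max₁ max₂ back₁ back₂)
    pigeonhole (inj₁ front₁) (inj₂ _) (inj₁ front₃) = inj₂ (inj₁ (at-front max₁ max₃ front₁ front₃))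
    pigeonhole (inj₂ back₁) (inj₁ _) (inj₂ back₃) = inj₂ (inj₁ (at-back max₁ max₃ back₁ back₃))
    pigeonhole (inj₁ _) (inj₂ back₂) (inj₂ back₃) = inj₂ (inj₂ (at-back max₂ max₃ back₂ back₃))
    pigeonhole (inj₂ _) (inj₁ front₂) (inj₁ front₃) = inj₂ (inj₂ (at-front max₂ max₃ front₂ front₃))

lemma20 : (G : Graph) → StronglyConnected G → Compressed G → ¬ IsClosedPath G →
    (e : Arc G) →
    (¬ BivalentArc G e →
      ∀ M M′ → MaximalMicrotig G M → e ∈ M → MaximalMicrotig G M′ → e ∈ M′ → M ≡ M′)
    × (BivalentArc G e →
      (∀ M₁ M₂ M₃ → MaximalMicrotig G M₁ → e ∈ M₁ → MaximalMicrotig G M₂ → e ∈ M₂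
         → MaximalMicrotig G M₃ → e ∈ M₃ → M₁ ≡ M₂ ⊎ M₁ ≡ M₃ ⊎ M₂ ≡ M₃)
      × (∀ W W′ → MaximalMicrotig G (e ∷ W) → MaximalMicrotig G (e ∷ W′) → W ≡ W′)
      × (∀ W W′ → MaximalMicrotig G (W ++ [ e ]) → MaximalMicrotig G (W′ ++ [ e ]) → W ≡ W′))
lemma20 G sc comp _ e = non-bivalent ,
  λ bivalent → at-most-two-maximal-through-bivalent bivalent ,
               maximal-starting-at-unique e , maximal-ending-at-unique e
  where
  open MaximalMicrotigs G sc comp
  non-bivalent : ¬ BivalentArc G e →
    ∀ M M′ → MaximalMicrotig G M → e ∈ M → MaximalMicrotig G M′ → e ∈ M′ → M ≡ M′
  non-bivalent ¬bivalent with 1 <? indeg G (Graph.hd G e)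
  ... | yes join = non-split-arc-in-unique-maximal (λ split → ¬bivalent (join , split))
  ... | no ¬join = non-join-arc-in-unique-maximal ¬join
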